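{- Let $F$ be an ordered field and consider Klein's model over $F$ in dimension 2: points are vectors $p \in F^2$ with $p \cdot p < 1$ (where $\cdot$ is the standard dot product); for points $a,b,c$, the betweenness $\beta(a,b,c)$ holds iff there exists $k \in F$ with $0 \le k \le 1$ and $b - a = k\,(c-a)$; and segments $ab$, $cd$ are congruent iff $$\frac{(1 - a\cdot b)^2}{(1 - a\cdot a)(1 - b\cdot b)} = \frac{(1 - c\cdot d)^2}{(1 - c\cdot c)(1 - d\cdot d)}.$$ Then the following axiom (Proclus' postulate) does not hold in this model: for all points $A,B,C,D,P,Q$, if $\mathrm{Par}(A,B,C,D)$, $\mathrm{Col}(A,B,P)$ and $\lnot\mathrm{Col}(A,B,Q)$, then there exists a point $Y$ with $\mathrm{Col}(C,D,Y)$ and $\mathrm{Col}(P,Q,Y)$.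
   Context: All points below range over the points of the model (vectors strictly inside the unit disk). $\mathrm{Col}(A,B,C)$ holds iff $\beta(A,B,C) \lor \beta(B,C,A) \lor \beta(C,A,B)$. $\mathrm{Coplanar}(A,B,C,D)$ holds iff there is a point $X$ with $(\mathrm{Col}(A,B,X)\land \mathrm{Col}(C,D,X)) \lor (\mathrm{Col}(A,C,X)\land \mathrm{Col}(B,D,X)) \lor (\mathrm{Col}(A,D,X)\land \mathrm{Col}(B,C,X))$. $\mathrm{Par}(A,B,C,D)$ holds iff either ($A \neq B$, $C \neq D$, $\mathrm{Coplanar}(A,B,C,D)$, and there is no point $X$ with $\mathrm{Col}(X,A,B)$ and $\mathrm{Col}(X,C,D)$), or ($A \neq B$, $C \neq D$, $\mathrm{Col}(A,C,D)$ and $\mathrm{Col}(B,C,D)$). -}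

module Defs where

open import Level using (Level; _⊔_) renaming (suc to lsuc)
open import Algebra.Bundles using (CommutativeRing)
open import Relation.Binary.Core using (Rel)
open import Relation.Binary.Structures using (IsTotalOrder)
open import Relation.Nullary using (¬_)
open import Data.Product using (Σ; ∃; _×_; _,_)
open import Data.Sum using (_⊎_)

record OrderedField (c ℓ₁ ℓ₂ : Level) : Set (lsuc (c ⊔ ℓ₁ ⊔ ℓ₂)) where
  field
    commutativeRing : CommutativeRing c ℓ₁
  open CommutativeRing commutativeRing public
  field
    _≤_          : Rel Carrier ℓ₂
    isTotalOrder : IsTotalOrder _≈_ _≤_
    0≉1          : ¬ (0# ≈ 1#)
    inverse      : ∀ x → ¬ (x ≈ 0#) → Σ Carrier (λ y → x * y ≈ 1#)
    +-mono-≤     : ∀ {x y} z → x ≤ y → (x + z) ≤ (y + z)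
    *-nonneg     : ∀ {x y} → 0# ≤ x → 0# ≤ y → 0# ≤ (x * y)

  _<_ : Rel Carrier (ℓ₁ ⊔ ℓ₂)
  x < y = (x ≤ y) × ¬ (x ≈ y)

module Klein {c ℓ₁ ℓ₂ : Level} (F : OrderedField c ℓ₁ ℓ₂) where
  open OrderedField F

  record Vec2 : Set c where
    constructor vec
    field
      px py : Carrier
  open Vec2 public

  _·_ : Vec2 → Vec2 → Carrier
  u · v = (px u * px v) + (py u * py v)

  _⊖_ : Vec2 → Vec2 → Vec2
  u ⊖ v = vec (px u - px v) (py u - py v)

  _⊛_ : Carrier → Vec2 → Vec2
  k ⊛ v = vec (k * px v) (k * py v)

  _≈V_ : Vec2 → Vec2 → Set ℓ₁
  u ≈V v = (px u ≈ px v) × (py u ≈ py v)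

  record Point : Set (c ⊔ ℓ₁ ⊔ ℓ₂) where
    constructor pt
    field
      vecOf  : Vec2
      inside : (vecOf · vecOf) < 1#
  open Point public

  β : Point → Point → Point → Set (c ⊔ ℓ₁ ⊔ ℓ₂)
  β a b d = ∃ λ k → (0# ≤ k) × (k ≤ 1#) ×
              ((vecOf b ⊖ vecOf a) ≈V (k ⊛ (vecOf d ⊖ vecOf a)))

  -- congruence (cross-multiplied form of the equality of the two
  -- fractions; the denominators are nonzero since points satisfy p·p < 1)
  Cong : Point → Point → Point → Point → Set ℓ₁
  Cong a b d e =
    let sq : Carrier → Carrier
        sq t = t * t
        A = vecOf a ; B = vecOf b ; D = vecOf d ; E = vecOf e
    in ((sq (1# - (A · B)) * ((1# - (D · D)) * (1# - (E · E)))) ≈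
        (sq (1# - (D · E)) * ((1# - (A · A)) * (1# - (B · B)))))

  _≠_ : Point → Point → Set ℓ₁
  a ≠ b = ¬ (vecOf a ≈V vecOf b)

  Col : Point → Point → Point → Set (c ⊔ ℓ₁ ⊔ ℓ₂)
  Col a b d = β a b d ⊎ β b d a ⊎ β d a b

  Coplanar : Point → Point → Point → Point → Set (c ⊔ ℓ₁ ⊔ ℓ₂)
  Coplanar a b d e = ∃ λ x →
      (Col a b x × Col d e x) ⊎ (Col a d x × Col b e x) ⊎ (Col a e x × Col b d x)

  Par : Point → Point → Point → Point → Set (c ⊔ ℓ₁ ⊔ ℓ₂)
  Par a b d e =
      (a ≠ b × d ≠ e × Coplanar a b d e × ¬ (∃ λ x → Col x a b × Col x d e))
    ⊎ (a ≠ b × d ≠ e × Col a d e × Col b d e)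

  ProclusPostulate : Set (c ⊔ ℓ₁ ⊔ ℓ₂)
  ProclusPostulate = ∀ A B C D P Q →
    Par A B C D → Col A B P → ¬ Col A B Q →
    ∃ λ Y → Col C D Y × Col P Q Y

-- Lines of the model are the chords n · p = d of the disk, and β is
-- betweenness of coordinate vectors, so anything collinear with two distinct
-- points of such a line satisfies its equation (Col⇒OnLine). Take
-- A = (0,0), B = (½,0), C = (0,½), D = (½,½). The lines y = 0 and y = ½ share
-- no point, and the four points are coplanar because the diagonals AD and BC
-- meet at (¼,¼); hence Par A B C D. The line through P = A and Q = (½,¼),
-- which is not on AB, could only meet CD at (1,½), outside the disk.

module Submission where

open import Algebra.Bundles using (CommutativeRing; RawRing)
open import Data.Empty using (⊥; ⊥-elim)
open import Data.Maybe using (Maybe; just; nothing)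
open import Data.Nat as ℕ using (ℕ; zero; suc)
open import Data.Nat.Properties using (+-suc)
open import Data.Product using (∃; _×_; _,_; proj₁; proj₂)
open import Data.Sum using (inj₁; inj₂)
open import Level using (0ℓ)
open import Relation.Binary.PropositionalEquality as ≡ using (_≡_)
open import Relation.Binary.Structures using (IsTotalOrder)
open import Relation.Nullary using (¬_; yes; no)
import Algebra.Solver.Ring as RingSolver
open import Algebra.Solver.Ring.AlmostCommutativeRing using (fromCommutativeRing; _-Raw-AlmostCommutative⟶_)

open import Defs

-- The library's solvers for rings with an abstract carrier have no way to
-- cancel constants (as in 1 - 1 = 0); integer coefficients provide one.
module IntegerCoefficientSolver {c ℓ} (R : CommutativeRing c ℓ) where
  open CommutativeRing R
  open import Algebra.Properties.Semiring.Mult.TCOptimised semiring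
    using (×-homo-+; ×1-homo-*) renaming (_×_ to _×′_)
  open import Algebra.Properties.Ring ring using (x[y-z]≈xy-xz; -‿distribˡ-*; -0#≈0#; -‿+-comm; ⁻¹-anti-homo‿-)
  open import Algebra.Properties.CommutativeSemigroup +-commutativeSemigroup using (interchange)
  open import Relation.Binary.Reasoning.Setoid setoid

  -- Integer coefficients are formal differences (m , n) ↦ m − n, kept in
  -- the canonical form (m , 0) or (0 , n): the solver compares normal forms
  -- syntactically, so equal integers must have equal representations.
  canonical : ℕ × ℕ → ℕ × ℕ
  canonical (suc m , suc n) = canonical (m , n)
  canonical mn              = mn

  ℤ-rawRing : RawRing 0ℓ 0ℓ
  ℤ-rawRing = record
    { Carrier = ℕ × ℕ
    ; _≈_     = _≡_
    ; _+_     = λ { (m , n) (p , q) → canonical (m ℕ.+ p , n ℕ.+ q) }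
    ; _*_     = λ { (m , n) (p , q) → canonical (m ℕ.* p ℕ.+ n ℕ.* q , m ℕ.* q ℕ.+ n ℕ.* p) }
    ; -_      = λ { (m , n) → (n , m) }
    ; 0#      = (0 , 0)
    ; 1#      = (1 , 0)
    }

  +-minus-distrib : ∀ x y z w → (x + y) - (z + w) ≈ (x - z) + (y - w)
  +-minus-distrib x y z w = begin
    (x + y) - (z + w)     ≈⟨ +-congˡ (-‿+-comm z w) ⟨
    (x + y) + (- z + - w) ≈⟨ interchange x y (- z) (- w) ⟩
    (x - z) + (y - w)     ∎

  minus-cong : ∀ {x y z w} → x + w ≈ z + y → x - y ≈ z - w
  minus-cong {x} {y} {z} {w} x+w≈z+y = begin
    x - y                   ≈⟨ +-identityʳ (x - y) ⟨
    (x - y) + 0#            ≈⟨ +-congˡ (-‿inverseʳ w) ⟨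
    (x - y) + (w - w)       ≈⟨ +-minus-distrib x w y w ⟨
    (x + w) - (y + w)       ≈⟨ +-cong x+w≈z+y (-‿cong (+-comm y w)) ⟩
    (z + y) - (w + y)       ≈⟨ +-minus-distrib z y w y ⟩
    (z - w) + (y - y)       ≈⟨ +-congˡ (-‿inverseʳ y) ⟩
    (z - w) + 0#            ≈⟨ +-identityʳ (z - w) ⟩
    z - w                   ∎

  [x-y]z≈xz-yz : ∀ x y z → (x - y) * z ≈ x * z - y * z
  [x-y]z≈xz-yz x y z = trans (distribʳ z x (- y)) (+-congˡ (sym (-‿distribˡ-* y z)))

  minus-*-minus : ∀ x y z w → (x - y) * (z - w) ≈ (x * z + y * w) - (x * w + y * z)
  minus-*-minus x y z w = begin
    (x - y) * (z - w)                   ≈⟨ x[y-z]≈xy-xz (x - y) z w ⟩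
    (x - y) * z - (x - y) * w           ≈⟨ +-cong ([x-y]z≈xz-yz x y z) (-‿cong ([x-y]z≈xz-yz x y w)) ⟩
    (x * z - y * z) - (x * w - y * w)   ≈⟨ +-congˡ (⁻¹-anti-homo‿- (x * w) (y * w)) ⟩
    (x * z - y * z) + (y * w - x * w)   ≈⟨ +-minus-distrib (x * z) (y * w) (y * z) (x * w) ⟨
    (x * z + y * w) - (y * z + x * w)   ≈⟨ +-congˡ (-‿cong (+-comm (y * z) (x * w))) ⟩
    (x * z + y * w) - (x * w + y * z)   ∎

  difference : ℕ × ℕ → Carrier
  difference (m , n) = m ×′ 1# - n ×′ 1#

  difference-cong : ∀ m n p q → m ℕ.+ q ≡ p ℕ.+ n → difference (m , n) ≈ difference (p , q)
  difference-cong m n p q eq = minus-cong (begin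
    m ×′ 1# + q ×′ 1#  ≈⟨ ×-homo-+ 1# m q ⟨
    (m ℕ.+ q) ×′ 1#    ≡⟨ ≡.cong (_×′ 1#) eq ⟩
    (p ℕ.+ n) ×′ 1#    ≈⟨ ×-homo-+ 1# p n ⟩
    p ×′ 1# + n ×′ 1#  ∎)

  difference-canonical : ∀ x → difference (canonical x) ≈ difference x
  difference-canonical (zero  , n)     = refl
  difference-canonical (suc m , zero)  = refl
  difference-canonical (suc m , suc n) =
    trans (difference-canonical (m , n)) (difference-cong m n (suc m) (suc n) (+-suc m n))

  difference-+ : ∀ m n p q → difference (m ℕ.+ p , n ℕ.+ q) ≈ difference (m , n) + difference (p , q)
  difference-+ m n p q = begin
    (m ℕ.+ p) ×′ 1# - (n ℕ.+ q) ×′ 1#          ≈⟨ +-cong (×-homo-+ 1# m p) (-‿cong (×-homo-+ 1# n q)) ⟩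
    (m ×′ 1# + p ×′ 1#) - (n ×′ 1# + q ×′ 1#)  ≈⟨ +-minus-distrib _ _ _ _ ⟩
    difference (m , n) + difference (p , q)    ∎

  difference-* : ∀ m n p q →
    difference (m ℕ.* p ℕ.+ n ℕ.* q , m ℕ.* q ℕ.+ n ℕ.* p) ≈ difference (m , n) * difference (p , q)
  difference-* m n p q = begin
    (m ℕ.* p ℕ.+ n ℕ.* q) ×′ 1# - (m ℕ.* q ℕ.+ n ℕ.* p) ×′ 1#
      ≈⟨ +-cong (×1-homo-+-* m p n q) (-‿cong (×1-homo-+-* m q n p)) ⟩
    (M * P + N * Q) - (M * Q + N * P)
      ≈⟨ minus-*-minus M N P Q ⟨
    difference (m , n) * difference (p , q) ∎
    where
    M = m ×′ 1# ; N = n ×′ 1# ; P = p ×′ 1# ; Q = q ×′ 1#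
    ×1-homo-+-* : ∀ a b c d → (a ℕ.* b ℕ.+ c ℕ.* d) ×′ 1# ≈ a ×′ 1# * b ×′ 1# + c ×′ 1# * d ×′ 1#
    ×1-homo-+-* a b c d = trans (×-homo-+ 1# (a ℕ.* b) (c ℕ.* d)) (+-cong (×1-homo-* a b) (×1-homo-* c d))

  -- A nonnegative integer is sent to m ×′ 1# itself, so that the solver's
  -- constants 0 and 1 evaluate to 0# and 1# definitionally.
  ⟦_⟧ℤ : ℕ × ℕ → Carrier
  ⟦ m , zero  ⟧ℤ = m ×′ 1#
  ⟦ m , suc n ⟧ℤ = difference (m , suc n)

  ⟦⟧ℤ≈difference : ∀ x → ⟦ x ⟧ℤ ≈ difference x
  ⟦⟧ℤ≈difference (m , zero)  = sym (trans (+-congˡ -0#≈0#) (+-identityʳ (m ×′ 1#)))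
  ⟦⟧ℤ≈difference (m , suc n) = refl

  ⟦⟧ℤ-homomorphism : ℤ-rawRing -Raw-AlmostCommutative⟶ fromCommutativeRing R
  ⟦⟧ℤ-homomorphism = record
    { ⟦_⟧    = ⟦_⟧ℤ
    ; +-homo = λ { (m , n) (p , q) → via (m ℕ.+ p , n ℕ.+ q)
                     (trans (difference-+ m n p q) (sym (+-cong (⟦⟧ℤ≈difference (m , n)) (⟦⟧ℤ≈difference (p , q))))) }
    ; *-homo = λ { (m , n) (p , q) → via (m ℕ.* p ℕ.+ n ℕ.* q , m ℕ.* q ℕ.+ n ℕ.* p)
                     (trans (difference-* m n p q) (sym (*-cong (⟦⟧ℤ≈difference (m , n)) (⟦⟧ℤ≈difference (p , q))))) }
    ; -‿homo = λ { (m , n) → trans (⟦⟧ℤ≈difference (n , m))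
                     (trans (sym (⁻¹-anti-homo‿- (m ×′ 1#) (n ×′ 1#))) (-‿cong (sym (⟦⟧ℤ≈difference (m , n))))) }
    ; 0-homo = refl
    ; 1-homo = refl
    }
    where
    via : ∀ x {y} → difference x ≈ y → ⟦ canonical x ⟧ℤ ≈ y
    via x eq = trans (⟦⟧ℤ≈difference (canonical x)) (trans (difference-canonical x) eq)

  ≟-integer : ∀ x y → Maybe (⟦ x ⟧ℤ ≈ ⟦ y ⟧ℤ)
  ≟-integer (m , n) (p , q) with m ℕ.+ q ℕ.≟ p ℕ.+ n
  ... | yes eq = just (trans (⟦⟧ℤ≈difference (m , n)) (trans (difference-cong m n p q eq) (sym (⟦⟧ℤ≈difference (p , q)))))
  ... | no _   = nothing

  open RingSolver ℤ-rawRing (fromCommutativeRing R) ⟦⟧ℤ-homomorphism ≟-integer public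

  :0# :1# : ∀ {n} → Polynomial n
  :0# = con (0 , 0)
  :1# = con (1 , 0)

module OrderedFieldProperties {c ℓ₁ ℓ₂} (F : OrderedField c ℓ₁ ℓ₂) where
  open OrderedField F
  open IsTotalOrder isTotalOrder public using (total; antisym)
    renaming (refl to ≤-refl; trans to ≤-trans; ≲-respˡ-≈ to ≤-respˡ-≈; ≲-respʳ-≈ to ≤-respʳ-≈)
  open import Algebra.Properties.Ring ring using (x+x≈x⇒x≈0)
  open IntegerCoefficientSolver commutativeRing
  open import Relation.Binary.Reasoning.Setoid setoid

  x≤y⇒0≤y-x : ∀ {x y} → x ≤ y → 0# ≤ (y - x)
  x≤y⇒0≤y-x {x} x≤y = ≤-respˡ-≈ (-‿inverseʳ x) (+-mono-≤ (- x) x≤y)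

  0≤y-x⇒x≤y : ∀ {x y} → 0# ≤ (y - x) → x ≤ y
  0≤y-x⇒x≤y {x} {y} 0≤y-x =
    ≤-respʳ-≈ (solve 2 (λ x y → (y :- x) :+ x := y) refl x y)
      (≤-respˡ-≈ (+-identityˡ x) (+-mono-≤ x 0≤y-x))

  +-mono₂-≤ : ∀ {x y u v} → x ≤ y → u ≤ v → (x + u) ≤ (y + v)
  +-mono₂-≤ {x} {y} {u} {v} x≤y u≤v =
    ≤-trans (+-mono-≤ u x≤y) (≤-respˡ-≈ (+-comm u y) (≤-respʳ-≈ (+-comm v y) (+-mono-≤ y u≤v)))

  *-monoˡ-≤-nonNeg : ∀ {x y z} → 0# ≤ z → x ≤ y → (x * z) ≤ (y * z)
  *-monoˡ-≤-nonNeg {x} {y} {z} 0≤z x≤y = 0≤y-x⇒x≤y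
    (≤-respʳ-≈ (solve 3 (λ x y z → (y :- x) :* z := y :* z :- x :* z) refl x y z)
      (*-nonneg (x≤y⇒0≤y-x x≤y) 0≤z))

  0≤x*x : ∀ x → 0# ≤ (x * x)
  0≤x*x x with total 0# x
  ... | inj₁ 0≤x = *-nonneg 0≤x 0≤x
  ... | inj₂ x≤0 = ≤-respʳ-≈ (solve 1 (λ x → (:0# :- x) :* (:0# :- x) := x :* x) refl x)
                     (*-nonneg (x≤y⇒0≤y-x x≤0) (x≤y⇒0≤y-x x≤0))

  0≤1 : 0# ≤ 1#
  0≤1 = ≤-respʳ-≈ (*-identityˡ 1#) (0≤x*x 1#)

  square-mono-≤ : ∀ {x y} → 0# ≤ x → x ≤ y → (x * x) ≤ (y * y)
  square-mono-≤ {x} {y} 0≤x x≤y =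
    ≤-trans (*-monoˡ-≤-nonNeg 0≤x x≤y)
      (≤-respˡ-≈ (*-comm x y) (*-monoˡ-≤-nonNeg (≤-trans 0≤x x≤y) x≤y))

  ≤-<-trans : ∀ {x y z} → x ≤ y → y < z → x < z
  ≤-<-trans x≤y (y≤z , y≉z) = ≤-trans x≤y y≤z , λ x≈z → y≉z (antisym y≤z (≤-respˡ-≈ x≈z x≤y))

  x≉0∧x*y≈0⇒y≈0 : ∀ {x y} → ¬ x ≈ 0# → x * y ≈ 0# → y ≈ 0#
  x≉0∧x*y≈0⇒y≈0 {x} {y} x≉0 x*y≈0 with inverse x x≉0
  ... | x⁻¹ , x*x⁻¹≈1 = begin
    y                ≈⟨ *-identityˡ y ⟨
    1# * y           ≈⟨ *-congʳ x*x⁻¹≈1 ⟨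
    (x * x⁻¹) * y    ≈⟨ solve 3 (λ x x' y → (x :* x') :* y := x' :* (x :* y)) refl x x⁻¹ y ⟩
    x⁻¹ * (x * y)    ≈⟨ *-congˡ x*y≈0 ⟩
    x⁻¹ * 0#         ≈⟨ zeroʳ x⁻¹ ⟩
    0#               ∎

  1+1≉0 : ¬ 1# + 1# ≈ 0#
  1+1≉0 1+1≈0 = 0≉1 (antisym 0≤1 (≤-respʳ-≈ 1+1≈0 (≤-respˡ-≈ (+-identityˡ 1#) (+-mono-≤ 1# 0≤1))))

  ½ : Carrier
  ½ = proj₁ (inverse (1# + 1#) 1+1≉0)

  ½+½≈1 : ½ + ½ ≈ 1#
  ½+½≈1 = trans (solve 1 (λ h → h :+ h := (:1# :+ :1#) :* h) refl ½)
                (proj₂ (inverse (1# + 1#) 1+1≉0))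

  ½≉0 : ¬ ½ ≈ 0#
  ½≉0 ½≈0 = 0≉1 (begin
    0#       ≈⟨ +-identityʳ 0# ⟨
    0# + 0#  ≈⟨ +-cong ½≈0 ½≈0 ⟨
    ½ + ½    ≈⟨ ½+½≈1 ⟩
    1#       ∎)

  0≤½ : 0# ≤ ½
  0≤½ with total 0# ½
  ... | inj₁ 0≤½ = 0≤½
  ... | inj₂ ½≤0 = ⊥-elim (0≉1 (antisym 0≤1
                     (≤-respˡ-≈ ½+½≈1 (≤-respʳ-≈ (+-identityʳ 0#) (+-mono₂-≤ ½≤0 ½≤0)))))

  ½<1 : ½ < 1#
  ½<1 = ≤-respʳ-≈ ½+½≈1 (≤-respˡ-≈ (+-identityʳ ½) (+-mono₂-≤ ≤-refl 0≤½)) , ½≉1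
    where
    ½≉1 : ¬ ½ ≈ 1#
    ½≉1 ½≈1 = 0≉1 (sym (x+x≈x⇒x≈0 1# (trans (sym (+-cong ½≈1 ½≈1)) ½+½≈1)))

  ½*½+½*½≈½ : ½ * ½ + ½ * ½ ≈ ½
  ½*½+½*½≈½ = trans (sym (distribˡ ½ ½ ½)) (trans (*-congˡ ½+½≈1) (*-identityʳ ½))

  ½*x≈½⇒x≈1 : ∀ {x} → ½ * x ≈ ½ → x ≈ 1#
  ½*x≈½⇒x≈1 {x} ½*x≈½ = begin
    x                ≈⟨ *-identityˡ x ⟨
    1# * x           ≈⟨ *-congʳ ½+½≈1 ⟨
    (½ + ½) * x      ≈⟨ distribʳ x ½ ½ ⟩
    ½ * x + ½ * x    ≈⟨ +-cong ½*x≈½ ½*x≈½ ⟩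
    ½ + ½            ≈⟨ ½+½≈1 ⟩
    1#               ∎

module KleinLines {c ℓ₁ ℓ₂} (F : OrderedField c ℓ₁ ℓ₂) where
  open OrderedField F
  open Klein F
  open OrderedFieldProperties F using (≤-refl; ≤-respˡ-≈; 0≤1; 0≤x*x; +-mono₂-≤; ≤-<-trans; x≉0∧x*y≈0⇒y≈0)
  open import Algebra.Properties.Ring ring using (x∙y⁻¹≈ε⇒x≈y; +-cancelʳ)
  open IntegerCoefficientSolver commutativeRing
  open import Relation.Binary.Reasoning.Setoid setoid

  -- A record rather than a definition, so that n, d and p can be inferred
  -- from an argument of type OnLine n d p.
  record OnLine (n : Vec2) (d : Carrier) (p : Point) : Set ℓ₁ where
    constructor on-line
    field equation : n · vecOf p ≈ d

  ·-scale : ∀ n {u v w k} → (u ⊖ v) ≈V (k ⊛ (w ⊖ v)) → n · u - n · v ≈ k * (n · w - n · v)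
  ·-scale (vec α γ) {vec ux uy} {vec vx vy} {vec wx wy} {k} (x-eq , y-eq) = begin
    (α * ux + γ * uy) - (α * vx + γ * vy)
      ≈⟨ solve 6 (λ α γ ux uy vx vy → (α :* ux :+ γ :* uy) :- (α :* vx :+ γ :* vy)
                                       := α :* (ux :- vx) :+ γ :* (uy :- vy)) refl α γ ux uy vx vy ⟩
    α * (ux - vx) + γ * (uy - vy)
      ≈⟨ +-cong (*-congˡ x-eq) (*-congˡ y-eq) ⟩
    α * (k * (wx - vx)) + γ * (k * (wy - vy))
      ≈⟨ solve 7 (λ α γ vx vy wx wy k → α :* (k :* (wx :- vx)) :+ γ :* (k :* (wy :- vy))
                                       := k :* ((α :* wx :+ γ :* wy) :- (α :* vx :+ γ :* vy))) refl α γ vx vy wx wy k ⟩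
    k * ((α * wx + γ * wy) - (α * vx + γ * vy)) ∎

  ⊖-scaled-by-0 : ∀ {u v w k} → (u ⊖ v) ≈V (k ⊛ w) → k ≈ 0# → u ≈V v
  ⊖-scaled-by-0 {k = k} (x-eq , y-eq) k≈0 = coordinate x-eq , coordinate y-eq
    where
    coordinate : ∀ {a b t} → a - b ≈ k * t → a ≈ b
    coordinate {a} {b} {t} eq = x∙y⁻¹≈ε⇒x≈y a b (trans eq (trans (*-congʳ k≈0) (zeroˡ t)))

  ⊖-scaled-by-1 : ∀ {u v w k} → (u ⊖ w) ≈V (k ⊛ (v ⊖ w)) → k ≈ 1# → u ≈V v
  ⊖-scaled-by-1 {k = k} (x-eq , y-eq) k≈1 = coordinate x-eq , coordinate y-eq
    where
    coordinate : ∀ {a b t} → a - t ≈ k * (b - t) → a ≈ b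
    coordinate {a} {b} {t} eq = +-cancelʳ (- t) a b (trans eq (trans (*-congʳ k≈1) (*-identityˡ (b - t))))

  ≈V-sym : ∀ {u v} → u ≈V v → v ≈V u
  ≈V-sym (x-eq , y-eq) = sym x-eq , sym y-eq

  β-trivial : ∀ a b → β a a b
  β-trivial a b = 0# , ≤-refl , 0≤1 ,
    zero-difference (px (vecOf a)) (px (vecOf b)) , zero-difference (py (vecOf a)) (py (vecOf b))
    where
    zero-difference : ∀ x y → x - x ≈ 0# * (y - x)
    zero-difference x y = trans (-‿inverseʳ x) (sym (zeroˡ (y - x)))

  Col-rotate : ∀ {a b e} → Col e a b → Col a b e
  Col-rotate (inj₁ eab)        = inj₂ (inj₂ eab)
  Col-rotate (inj₂ (inj₁ abe)) = inj₁ abe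
  Col-rotate (inj₂ (inj₂ bea)) = inj₂ (inj₁ bea)

  px≉1 : ∀ p → ¬ px (vecOf p) ≈ 1#
  px≉1 (pt (vec x y) inside) x≈1 = proj₂ (≤-<-trans 1≤x*x+y*y inside) refl
    where
    1≤x*x+y*y : 1# ≤ (x * x + y * y)
    1≤x*x+y*y = ≤-respˡ-≈ (trans (+-identityʳ (x * x)) (trans (*-cong x≈1 x≈1) (*-identityˡ 1#)))
                  (+-mono₂-≤ ≤-refl (0≤x*x y))

  module _ {n : Vec2} {d : Carrier} {a b : Point} (a∈ab : OnLine n d a) (b∈ab : OnLine n d b) where
    private
      a∈ : n · vecOf a ≈ d
      a∈ = OnLine.equation a∈ab
      b∈ : n · vecOf b ≈ d
      b∈ = OnLine.equation b∈ab

    β-OnLine-beyond : a ≠ b → ∀ e → β a b e → n · vecOf e ≈ d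
    β-OnLine-beyond a≠b e (k , _ , _ , b-a≈k[e-a]) =
      x∙y⁻¹≈ε⇒x≈y (n · vecOf e) d (x≉0∧x*y≈0⇒y≈0 k≉0 (begin
        k * (n · vecOf e - d)                ≈⟨ *-congˡ (+-congˡ (-‿cong a∈)) ⟨
        k * (n · vecOf e - n · vecOf a)      ≈⟨ ·-scale n b-a≈k[e-a] ⟨
        n · vecOf b - n · vecOf a            ≈⟨ +-cong b∈ (-‿cong a∈) ⟩
        d - d                                ≈⟨ -‿inverseʳ d ⟩
        0#                                   ∎))
      where
      k≉0 : ¬ k ≈ 0#
      k≉0 k≈0 = a≠b (≈V-sym (⊖-scaled-by-0 b-a≈k[e-a] k≈0))

    β-OnLine-between : ∀ e → β b e a → n · vecOf e ≈ d
    β-OnLine-between e (k , _ , _ , e-b≈k[a-b]) = trans (x∙y⁻¹≈ε⇒x≈y (n · vecOf e) (n · vecOf b) (begin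
      n · vecOf e - n · vecOf b            ≈⟨ ·-scale n e-b≈k[a-b] ⟩
      k * (n · vecOf a - n · vecOf b)      ≈⟨ *-congˡ (+-cong a∈ (-‿cong b∈)) ⟩
      k * (d - d)                          ≈⟨ *-congˡ (-‿inverseʳ d) ⟩
      k * 0#                               ≈⟨ zeroʳ k ⟩
      0#                                   ∎)) b∈

    β-OnLine-behind : a ≠ b → ∀ e → β e a b → n · vecOf e ≈ d
    β-OnLine-behind a≠b e (k , _ , _ , a-e≈k[b-e]) =
      sym (x∙y⁻¹≈ε⇒x≈y d (n · vecOf e) (x≉0∧x*y≈0⇒y≈0 1-k≉0 (begin
        (1# - k) * (d - n · vecOf e)
          ≈⟨ solve 3 (λ k x y → (:1# :- k) :* (x :- y) := (x :- y) :- k :* (x :- y)) refl k d (n · vecOf e) ⟩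
        (d - n · vecOf e) - k * (d - n · vecOf e)
          ≈⟨ +-cong (+-congʳ a∈) (-‿cong (*-congˡ (+-congʳ b∈))) ⟨
        (n · vecOf a - n · vecOf e) - k * (n · vecOf b - n · vecOf e)
          ≈⟨ +-congʳ (·-scale n a-e≈k[b-e]) ⟩
        k * (n · vecOf b - n · vecOf e) - k * (n · vecOf b - n · vecOf e)
          ≈⟨ -‿inverseʳ _ ⟩
        0# ∎)))
      where
      1-k≉0 : ¬ 1# - k ≈ 0#
      1-k≉0 1-k≈0 = a≠b (⊖-scaled-by-1 a-e≈k[b-e] (sym (x∙y⁻¹≈ε⇒x≈y 1# k 1-k≈0)))

    Col⇒OnLine : a ≠ b → ∀ e → Col a b e → OnLine n d e
    Col⇒OnLine a≠b e (inj₁ abe)        = on-line (β-OnLine-beyond a≠b e abe)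
    Col⇒OnLine a≠b e (inj₂ (inj₁ bea)) = on-line (β-OnLine-between e bea)
    Col⇒OnLine a≠b e (inj₂ (inj₂ eab)) = on-line (β-OnLine-behind a≠b e eab)

module ProclusCounterexample {c ℓ₁ ℓ₂} (F : OrderedField c ℓ₁ ℓ₂) where
  open OrderedField F
  open Klein F
  open OrderedFieldProperties F
  open KleinLines F
  open IntegerCoefficientSolver commutativeRing
  open import Relation.Binary.Reasoning.Setoid setoid

  ¼ : Carrier
  ¼ = ½ * ½

  0≤¼ : 0# ≤ ¼
  0≤¼ = 0≤x*x ½

  ¼≤½ : ¼ ≤ ½
  ¼≤½ = ≤-respʳ-≈ (*-identityˡ ½) (*-monoˡ-≤-nonNeg 0≤½ (proj₁ ½<1))

  ½≤½ : ½ ≤ ½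
  ½≤½ = ≤-refl

  0≤0 : 0# ≤ 0#
  0≤0 = ≤-refl

  square-point : ∀ x y → 0# ≤ x → x ≤ ½ → 0# ≤ y → y ≤ ½ → Point
  square-point x y 0≤x x≤½ 0≤y y≤½ = pt (vec x y)
    (≤-<-trans (≤-respʳ-≈ ½*½+½*½≈½ (+-mono₂-≤ (square-mono-≤ 0≤x x≤½) (square-mono-≤ 0≤y y≤½))) ½<1)

  A B C D Q X : Point
  A = square-point 0# 0# 0≤0 0≤½ 0≤0 0≤½
  B = square-point ½  0# 0≤½ ½≤½ 0≤0 0≤½
  C = square-point 0# ½  0≤0 0≤½ 0≤½ ½≤½
  D = square-point ½  ½  0≤½ ½≤½ 0≤½ ½≤½
  Q = square-point ½  ¼  0≤½ ½≤½ 0≤¼ ¼≤½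
  X = square-point ¼  ¼  0≤¼ ¼≤½ 0≤¼ ¼≤½

  0≉½ : ¬ 0# ≈ ½
  0≉½ 0≈½ = ½≉0 (sym 0≈½)

  A≠B : A ≠ B
  A≠B A≈B = 0≉½ (proj₁ A≈B)

  C≠D : C ≠ D
  C≠D C≈D = 0≉½ (proj₁ C≈D)

  A≠Q : A ≠ Q
  A≠Q A≈Q = 0≉½ (proj₁ A≈Q)

  e₂ : Vec2
  e₂ = vec 0# 1#

  e₂·v≈py : ∀ v → e₂ · v ≈ py v
  e₂·v≈py (vec x y) = solve 2 (λ x y → :0# :* x :+ :1# :* y := y) refl x y

  A∈AB : OnLine e₂ 0# A
  A∈AB = on-line (e₂·v≈py (vecOf A))

  B∈AB : OnLine e₂ 0# B
  B∈AB = on-line (e₂·v≈py (vecOf B))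

  C∈CD : OnLine e₂ ½ C
  C∈CD = on-line (e₂·v≈py (vecOf C))

  D∈CD : OnLine e₂ ½ D
  D∈CD = on-line (e₂·v≈py (vecOf D))

  ¼-½≈½[0-½] : ¼ - ½ ≈ ½ * (0# - ½)
  ¼-½≈½[0-½] = begin
    ¼ - ½             ≈⟨ +-congˡ (-‿cong ½*½+½*½≈½) ⟨
    ¼ - (¼ + ¼)       ≈⟨ solve 1 (λ h → h :* h :- (h :* h :+ h :* h) := h :* (:0# :- h)) refl ½ ⟩
    ½ * (0# - ½)      ∎

  Par-ABCD : Par A B C D
  Par-ABCD = inj₁ (A≠B , C≠D , coplanar , disjoint)
    where
    coplanar : Coplanar A B C D
    -- X is the midpoint of both DA and CB: β D X A and β C X B with ratio ½.
    coplanar = X , inj₂ (inj₂ (inj₂ (inj₁ (½ , 0≤½ , proj₁ ½<1 , ¼-½≈½[0-½] , ¼-½≈½[0-½]))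
                              , inj₂ (inj₁ (½ , 0≤½ , proj₁ ½<1 , ¼-0≈½[½-0] , ¼-½≈½[0-½]))))
      where
      ¼-0≈½[½-0] : ¼ - 0# ≈ ½ * (½ - 0#)
      ¼-0≈½[½-0] = solve 1 (λ h → h :* h :- :0# := h :* (h :- :0#)) refl ½
    disjoint : ¬ (∃ λ x → Col x A B × Col x C D)
    disjoint (x , xAB , xCD) = 0≉½ (begin
      0#                 ≈⟨ OnLine.equation (Col⇒OnLine A∈AB B∈AB A≠B x (Col-rotate {A} {B} {x} xAB)) ⟨
      e₂ · vecOf x       ≈⟨ OnLine.equation (Col⇒OnLine C∈CD D∈CD C≠D x (Col-rotate {C} {D} {x} xCD)) ⟩
      ½                  ∎)

  Col-ABA : Col A B A
  Col-ABA = inj₂ (inj₂ (β-trivial A B))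

  ¬Col-ABQ : ¬ Col A B Q
  ¬Col-ABQ ABQ = ½≉0 (begin
    ½          ≈⟨ ½*½+½*½≈½ ⟨
    ¼ + ¼      ≈⟨ +-cong ¼≈0 ¼≈0 ⟩
    0# + 0#    ≈⟨ +-identityʳ 0# ⟩
    0#         ∎)
    where
    ¼≈0 : ¼ ≈ 0#
    ¼≈0 = trans (sym (e₂·v≈py (vecOf Q))) (OnLine.equation (Col⇒OnLine A∈AB B∈AB A≠B Q ABQ))

  AQ : Vec2
  AQ = vec ½ (- 1#)

  A∈AQ : OnLine AQ 0# A
  A∈AQ = on-line (solve 1 (λ h → h :* :0# :+ (:- :1#) :* :0# := :0#) refl ½)

  Q∈AQ : OnLine AQ 0# Q
  Q∈AQ = on-line (solve 1 (λ h → h :* h :+ (:- :1#) :* (h :* h) := :0#) refl ½)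

  CD∩AQ-outside : ∀ {Y} → OnLine e₂ ½ Y → OnLine AQ 0# Y → ⊥
  CD∩AQ-outside {Y@(pt (vec x y) _)} (on-line y≈½) (on-line ½x-y≈0) = px≉1 Y (½*x≈½⇒x≈1 (begin
    ½ * x                     ≈⟨ solve 3 (λ h x y → h :* x := (h :* x :+ (:- :1#) :* y) :+ y) refl ½ x y ⟩
    (½ * x + - 1# * y) + y    ≈⟨ +-cong ½x-y≈0 (trans (sym (e₂·v≈py (vec x y))) y≈½) ⟩
    0# + ½                    ≈⟨ +-identityˡ ½ ⟩
    ½                         ∎))

  ¬Proclus : ¬ ProclusPostulate
  ¬Proclus proclus =
    let Y , CDY , AQY = proclus A B C D A Q Par-ABCD Col-ABA ¬Col-ABQ
    in CD∩AQ-outside (Col⇒OnLine C∈CD D∈CD C≠D Y CDY) (Col⇒OnLine A∈AQ Q∈AQ A≠Q Y AQY)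

theorem1 : ∀ {c ℓ₁ ℓ₂} (F : OrderedField c ℓ₁ ℓ₂) → ¬ Klein.ProclusPostulate F
theorem1 F = ProclusCounterexample.¬Proclus F
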